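{- Let $x\in\mathsf{Pop}_{\mathrm{Weak}(B_n)}(\mathrm{Weak}(B_n))$. Then for every $k$ such that $\mathrm{asc}_{k+1}(x)$ exists, the first entry of $\mathrm{asc}_k(x)$ is smaller than the last entry of $\mathrm{asc}_{k+1}(x)$.
   Context: $B_n$ is the set of permutations $x=x_1\cdots x_{2n}$ of $\{1,\dots,2n\}$ with $x_i+x_{2n+1-i}=2n+1$ for all $i$; $\mathrm{Weak}(B_n)$ is $B_n$ with the right weak order ($x\le y$ iff every pair of values $a<b$ with $b$ before $a$ in $x$ also has $b$ before $a$ in $y$). For a finite lattice $M$, $\mathsf{Pop}_M(x)$ is the meet of $x$ and all elements it covers; in $\mathrm{Weak}(B_n)$ this amounts to reversing each maximal descending run of $x$. $\mathrm{asc}_k(x)$ denotes the $k$-th maximal ascending run (maximal consecutive increasing substring) of $x$ counted from the left. -}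

module Defs where

open import Data.Nat using (ℕ; zero; suc; _+_; _∸_; _<_; _<?_)
open import Data.List using (List; []; _∷_; map; upTo; length)
open import Data.List.Relation.Binary.Permutation.Propositional using (_↭_)
open import Data.Maybe using (Maybe; just; nothing)
open import Data.Product using (_×_; ∃-syntax)
open import Data.Sum using (_⊎_)
open import Relation.Nullary using (¬_; yes; no)
open import Relation.Binary.PropositionalEquality using (_≡_)

-- 0-indexed entry of a list (0 outside the range; only used in range)
nth : List ℕ → ℕ → ℕ
nth []       _       = 0
nth (a ∷ _)  zero    = a
nth (_ ∷ xs) (suc i) = nth xs i

_‼_ : {A : Set} → List A → ℕ → Maybe A
[]       ‼ _       = nothing
(a ∷ _)  ‼ zero    = just a
(_ ∷ xs) ‼ (suc i) = xs ‼ i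

IsPerm : ℕ → List ℕ → Set
IsPerm n x = x ↭ map suc (upTo (n + n))

-- x_i + x_{2n+1-i} = 2n+1 for all i (here 0-indexed: positions i and 2n-1-i)
IsSigned : ℕ → List ℕ → Set
IsSigned n x = ∀ i → i < n + n → nth x i + nth x ((n + n) ∸ suc i) ≡ suc (n + n)

B : ℕ → List ℕ → Set
B n x = IsPerm n x × IsSigned n x

Inv : List ℕ → ℕ → ℕ → Set
Inv x a b = a < b × ∃[ i ] ∃[ j ] (i < j × j < length x × nth x i ≡ b × nth x j ≡ a)

_≤w_ : List ℕ → List ℕ → Set
x ≤w y = ∀ a b → Inv x a b → Inv y a b

Covered : ℕ → List ℕ → List ℕ → Set
Covered n z y = B n z × z ≤w y × ¬ (z ≡ y)
  × (∀ w → B n w → z ≤w w → w ≤w y → w ≡ z ⊎ w ≡ y)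

IsMeet : ℕ → (List ℕ → Set) → List ℕ → Set
IsMeet n P z = B n z × (∀ s → P s → z ≤w s)
  × (∀ w → B n w → (∀ s → P s → w ≤w s) → w ≤w z)

IsPopOf : ℕ → List ℕ → List ℕ → Set
IsPopOf n y x = IsMeet n (λ s → s ≡ y ⊎ Covered n s y) x

InPopImage : ℕ → List ℕ → Set
InPopImage n x = ∃[ y ] (B n y × IsPopOf n y x)

consHead : ℕ → List (List ℕ) → List (List ℕ)
consHead a []         = (a ∷ []) ∷ []
consHead a (r ∷ rs)   = (a ∷ r) ∷ rs

runsFrom : ℕ → List ℕ → List (List ℕ)
runsFrom a []       = (a ∷ []) ∷ []
runsFrom a (b ∷ xs) with a <? b
... | yes _ = consHead a (runsFrom b xs)
... | no _  = (a ∷ []) ∷ runsFrom b xs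

ascRuns : List ℕ → List (List ℕ)
ascRuns []       = []
ascRuns (a ∷ xs) = runsFrom a xs

{-# OPTIONS --safe #-}
-- Let x = Pop(y), the meet of y and its lower covers; each lower cover of y undoes one descent of y
-- together with its mirror image. As x lies below all of them, x reverses every descending run of y.
-- As swapping an ascent of x (with its mirror) must not give another lower bound of them, an ascent of x
-- whose letters are inverted in y is adjacent in y; hence two letters keep their order from y whenever
-- an ascent of y lies between them.
-- Now let x_i … x_p and x_{p+1} … x_j be consecutive ascending runs of x. The inversion x_p > x_{p+1} of x
-- is one of y, and since Pop did not undo it, y has an ascent y_t < y_{t+1} between these two letters;
-- take the first one. The facts above force x_i ≤ y_t and y_{t+1} ≤ x_j.
module Submission where

open import Defs
open import Data.Nat using (ℕ; zero; suc; _+_; _∸_; _<_; _≤_; _<?_; _≤?_; _≟_; z≤n; s≤s)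
open import Data.Nat.Properties
open import Data.List using (List; []; _∷_; map; upTo; length; head; last)
open import Data.List.Properties using (length-map; length-upTo)
open import Data.List.Membership.Propositional using (_∈_)
open import Data.List.Relation.Unary.Any using (here; there)
open import Data.List.Relation.Unary.All using (All; _∷_)
open import Data.List.Relation.Unary.AllPairs using (_∷_)
open import Data.List.Relation.Unary.Unique.Propositional using (Unique)
import Data.List.Relation.Unary.Unique.Propositional.Properties as Unique
open import Data.List.Relation.Binary.Permutation.Propositional using (_↭_; ↭-sym; ↭-trans; ↭⇒↭ₛ; ↭-refl; prep; swap)
open import Data.List.Relation.Binary.Permutation.Propositional.Properties using (∈-resp-↭; ↭-length)
import Data.List.Relation.Binary.Permutation.Setoid.Properties as Perm
open import Data.Maybe using (just)
open import Data.Maybe.Properties using (just-injective)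
open import Data.Product using (_×_; _,_; proj₁; proj₂; ∃-syntax; Σ)
open import Data.Sum using (_⊎_; inj₁; inj₂)
open import Data.Empty using (⊥; ⊥-elim)
open import Relation.Nullary using (¬_; yes; no; Dec)
open import Relation.Nullary.Decidable using (_×-dec_)
open import Relation.Binary.Definitions using (tri<; tri≈; tri>)
open import Relation.Binary.PropositionalEquality
  using (_≡_; _≢_; refl; sym; trans; cong; cong₂; subst; subst₂; module ≡-Reasoning)
open import Relation.Binary.PropositionalEquality.Properties using (setoid)

-- Positions of letters in words

Occurs : List ℕ → ℕ → Set
Occurs l u = ∃[ i ] (i < length l × nth l i ≡ u)

Precedes : List ℕ → ℕ → ℕ → Set
Precedes l u v = ∃[ i ] ∃[ j ] (i < j × j < length l × nth l i ≡ u × nth l j ≡ v)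

record NthInjective (l : List ℕ) : Set where
  field nth-injective : ∀ {i j} → i < length l → j < length l → nth l i ≡ nth l j → i ≡ j
open NthInjective public

∈⇒occurs : ∀ {u} (l : List ℕ) → u ∈ l → Occurs l u
∈⇒occurs (a ∷ l) (here refl) = 0 , s≤s z≤n , refl
∈⇒occurs (a ∷ l) (there p) with ∈⇒occurs l p
... | i , i< , e = suc i , s≤s i< , e

occurs⇒∈ : ∀ {u} (l : List ℕ) → Occurs l u → u ∈ l
occurs⇒∈ (a ∷ l) (zero , _ , refl) = here refl
occurs⇒∈ (a ∷ l) (suc i , s≤s i< , e) = there (occurs⇒∈ l (i , i< , e))

All≢⇒≢nth : ∀ {a} (l : List ℕ) → All (a ≢_) l → ∀ {j} → j < length l → a ≢ nth l j
All≢⇒≢nth (b ∷ l) (p ∷ ps) {zero} _ = p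
All≢⇒≢nth (b ∷ l) (p ∷ ps) {suc j} (s≤s j<) = All≢⇒≢nth l ps j<

unique⇒nthInjective : (l : List ℕ) → Unique l → NthInjective l
unique⇒nthInjective l u = record { nth-injective = go l u }
  where
  go : (l : List ℕ) → Unique l → ∀ {i j} → i < length l → j < length l → nth l i ≡ nth l j → i ≡ j
  go (a ∷ l) (p ∷ ps) {zero} {zero} _ _ _ = refl
  go (a ∷ l) (p ∷ ps) {zero} {suc j} _ (s≤s j<) e = ⊥-elim (All≢⇒≢nth l p j< e)
  go (a ∷ l) (p ∷ ps) {suc i} {zero} (s≤s i<) _ e = ⊥-elim (All≢⇒≢nth l p i< (sym e))
  go (a ∷ l) (p ∷ ps) {suc i} {suc j} (s≤s i<) (s≤s j<) e = cong suc (go l ps i< j< e)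

range : ℕ → List ℕ
range N = map suc (upTo N)

↭range⇒unique : ∀ {l N} → l ↭ range N → Unique l
↭range⇒unique {N = N} p =
  Perm.Unique-resp-↭ (setoid ℕ) (↭⇒↭ₛ (↭-sym p)) (Unique.map⁺ suc-injective (Unique.upTo⁺ N))

module _ {l : List ℕ} (inj : NthInjective l) where

  precedes-irrefl : ∀ {u} → ¬ Precedes l u u
  precedes-irrefl (i , j , i<j , j< , refl , e) =
    <-irrefl (nth-injective inj (<-trans i<j j<) j< (sym e)) i<j

  precedes-asym : ∀ {u v} → Precedes l u v → ¬ Precedes l v u
  precedes-asym (i , j , i<j , j< , refl , refl) (i′ , j′ , i′<j′ , j′< , e₁ , e₂) =
    <-asym i<j (subst₂ _<_ (nth-injective inj (<-trans i′<j′ j′<) j< e₁) (nth-injective inj j′< (<-trans i<j j<) e₂) i′<j′)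

  precedes-trans : ∀ {u v w} → Precedes l u v → Precedes l v w → Precedes l u w
  precedes-trans (i , j , i<j , j< , e₁ , refl) (i′ , j′ , i′<j′ , j′< , e₂ , e₃) =
    i , j′ , <-trans i<j (subst (_< j′) (nth-injective inj (<-trans i′<j′ j′<) j< e₂) i′<j′) , j′< , e₁ , e₃

  precedes-total : ∀ {u v} → Occurs l u → Occurs l v → u ≢ v → Precedes l u v ⊎ Precedes l v u
  precedes-total (i , i< , e₁) (j , j< , e₂) u≢v with <-cmp i j
  ... | tri< i<j _ _ = inj₁ (i , j , i<j , j< , e₁ , e₂)
  ... | tri≈ _ refl _ = ⊥-elim (u≢v (trans (sym e₁) e₂))
  ... | tri> _ _ j<i = inj₂ (j , i , j<i , i< , e₂ , e₁)

  precedes? : ∀ {u v} → Occurs l u → Occurs l v → Dec (Precedes l u v)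
  precedes? (i , i< , e₁) (j , j< , e₂) with i <? j
  ... | yes i<j = yes (i , j , i<j , j< , e₁ , e₂)
  ... | no i≮j = no λ (i′ , j′ , i′<j′ , j′< , e₃ , e₄) →
    i≮j (subst₂ _<_ (nth-injective inj (<-trans i′<j′ j′<) i< (trans e₃ (sym e₁)))
                    (nth-injective inj j′< j< (trans e₄ (sym e₂))) i′<j′)

precedes⇒occurs₁ : ∀ {l u v} → Precedes l u v → Occurs l u
precedes⇒occurs₁ (i , j , i<j , j< , e , _) = i , <-trans i<j j< , e

precedes⇒occurs₂ : ∀ {l u v} → Precedes l u v → Occurs l v
precedes⇒occurs₂ (i , j , _ , j< , _ , e) = j , j< , e

nth-extensionality : ∀ (a b : List ℕ) → length a ≡ length b → (∀ i → i < length a → nth a i ≡ nth b i) → a ≡ b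
nth-extensionality [] [] _ _ = refl
nth-extensionality (u ∷ a) (v ∷ b) e f =
  cong₂ _∷_ (f 0 (s≤s z≤n)) (nth-extensionality a b (suc-injective e) (λ i i< → f (suc i) (s≤s i<)))

AscendingOn : List ℕ → ℕ → ℕ → Set
AscendingOn l lo hi = ∀ k → lo ≤ k → k < hi → nth l k < nth l (suc k)

DescendingOn : List ℕ → ℕ → ℕ → Set
DescendingOn l lo hi = ∀ k → lo ≤ k → k < hi → nth l (suc k) < nth l k

ascendingOn-mono : ∀ {l lo hi} → AscendingOn l lo hi → ∀ {k k′} → lo ≤ k → k ≤ k′ → k′ ≤ hi → nth l k ≤ nth l k′
ascendingOn-mono asc {k} {k′} lo≤k k≤k′ k′≤hi with m≤n⇒m<n∨m≡n k≤k′
ascendingOn-mono asc {k} {k′} lo≤k k≤k′ k′≤hi | inj₂ refl = ≤-refl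
ascendingOn-mono {l} asc {k} {suc k′} lo≤k k≤k′ k′≤hi | inj₁ k<k′ =
  ≤-trans (ascendingOn-mono {l} asc lo≤k (≤-pred k<k′) (≤-trans (n≤1+n k′) k′≤hi))
          (<⇒≤ (asc k′ (≤-trans lo≤k (≤-pred k<k′)) k′≤hi))

RunStart : List ℕ → ℕ → Set
RunStart l i = i ≡ 0 ⊎ ∃[ i′ ] (i ≡ suc i′ × ¬ (nth l i′ < nth l i))

RunEnd : List ℕ → ℕ → Set
RunEnd l j = suc j ≡ length l ⊎ ¬ (nth l j < nth l (suc j))

-- Adjacent transpositions

swapAt : ℕ → List ℕ → List ℕ
swapAt zero (a ∷ b ∷ l) = b ∷ a ∷ l
swapAt zero l = l
swapAt (suc t) [] = []
swapAt (suc t) (a ∷ l) = a ∷ swapAt t l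

swapIndex : ℕ → ℕ → ℕ
swapIndex zero zero = 1
swapIndex zero (suc zero) = 0
swapIndex zero (suc (suc i)) = suc (suc i)
swapIndex (suc t) zero = zero
swapIndex (suc t) (suc i) = suc (swapIndex t i)

length-swapAt : ∀ t l → length (swapAt t l) ≡ length l
length-swapAt zero [] = refl
length-swapAt zero (a ∷ []) = refl
length-swapAt zero (a ∷ b ∷ l) = refl
length-swapAt (suc t) [] = refl
length-swapAt (suc t) (a ∷ l) = cong suc (length-swapAt t l)

swapAt-↭ : ∀ t l → swapAt t l ↭ l
swapAt-↭ zero [] = ↭-refl
swapAt-↭ zero (a ∷ []) = ↭-refl
swapAt-↭ zero (a ∷ b ∷ l) = swap b a ↭-refl
swapAt-↭ (suc t) [] = ↭-refl
swapAt-↭ (suc t) (a ∷ l) = prep a (swapAt-↭ t l)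

nth-swapAt : ∀ t l → suc t < length l → ∀ i → nth (swapAt t l) i ≡ nth l (swapIndex t i)
nth-swapAt zero (a ∷ []) (s≤s ()) i
nth-swapAt zero (a ∷ b ∷ l) _ zero = refl
nth-swapAt zero (a ∷ b ∷ l) _ (suc zero) = refl
nth-swapAt zero (a ∷ b ∷ l) _ (suc (suc i)) = refl
nth-swapAt (suc t) (a ∷ l) _ zero = refl
nth-swapAt (suc t) (a ∷ l) (s≤s h) (suc i) = nth-swapAt t l h i

swapIndex-left : ∀ t → swapIndex t t ≡ suc t
swapIndex-left zero = refl
swapIndex-left (suc t) = cong suc (swapIndex-left t)

swapIndex-right : ∀ t → swapIndex t (suc t) ≡ t
swapIndex-right zero = refl
swapIndex-right (suc t) = cong suc (swapIndex-right t)

swapIndex-other : ∀ t i → i ≢ t → i ≢ suc t → swapIndex t i ≡ i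
swapIndex-other zero zero i≢t _ = ⊥-elim (i≢t refl)
swapIndex-other zero (suc zero) _ i≢1+t = ⊥-elim (i≢1+t refl)
swapIndex-other zero (suc (suc i)) _ _ = refl
swapIndex-other (suc t) zero _ _ = refl
swapIndex-other (suc t) (suc i) i≢t i≢1+t =
  cong suc (swapIndex-other t i (λ e → i≢t (cong suc e)) (λ e → i≢1+t (cong suc e)))

swapIndex-involutive : ∀ t i → swapIndex t (swapIndex t i) ≡ i
swapIndex-involutive zero zero = refl
swapIndex-involutive zero (suc zero) = refl
swapIndex-involutive zero (suc (suc i)) = refl
swapIndex-involutive (suc t) zero = refl
swapIndex-involutive (suc t) (suc i) = cong suc (swapIndex-involutive t i)

swapIndex-< : ∀ t i L → suc t < L → i < L → swapIndex t i < L
swapIndex-< zero zero L h _ = h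
swapIndex-< zero (suc zero) L h _ = <-trans (s≤s z≤n) h
swapIndex-< zero (suc (suc i)) L h i< = i<
swapIndex-< (suc t) zero L h i< = i<
swapIndex-< (suc t) (suc i) (suc L) (s≤s h) (s≤s i<) = s≤s (swapIndex-< t i L h i<)

swapIndex-mono-< : ∀ t i j → i < j → ¬ (i ≡ t × j ≡ suc t) → swapIndex t i < swapIndex t j
swapIndex-mono-< zero zero (suc zero) _ h = ⊥-elim (h (refl , refl))
swapIndex-mono-< zero zero (suc (suc j)) _ _ = s≤s (s≤s z≤n)
swapIndex-mono-< zero (suc zero) (suc (suc j)) _ _ = s≤s z≤n
swapIndex-mono-< zero (suc (suc i)) (suc (suc j)) i<j _ = i<j
swapIndex-mono-< zero (suc zero) (suc zero) (s≤s ()) _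
swapIndex-mono-< zero (suc (suc i)) (suc zero) (s≤s ()) _
swapIndex-mono-< (suc t) zero (suc j) _ _ = s≤s z≤n
swapIndex-mono-< (suc t) (suc i) (suc j) (s≤s i<j) h =
  s≤s (swapIndex-mono-< t i j i<j (λ (a , b) → h (cong suc a , cong suc b)))

-- Signed permutations

odd≢even : ∀ a b → suc (a + a) ≢ b + b
odd≢even zero zero ()
odd≢even zero (suc b) e rewrite +-suc b b with e
... | ()
odd≢even (suc a) zero ()
odd≢even (suc a) (suc b) e rewrite +-suc a a | +-suc b b = odd≢even a b (suc-injective (suc-injective e))

module SignedPermutations (n : ℕ) where

  N : ℕ
  N = n + n

  record Mirror (i k : ℕ) : Set where
    constructor mirror
    field mirror-sum : suc (i + k) ≡ N

  mirror-of : ∀ {i} → i < N → Mirror i (N ∸ suc i)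
  mirror-of i< = mirror (m+[n∸m]≡n i<)

  mirror-index : ∀ {i k} → Mirror i k → N ∸ suc i ≡ k
  mirror-index {i} {k} (mirror e) = trans (cong (_∸ suc i) (sym e)) (m+n∸m≡n (suc i) k)

  mirror-sym : ∀ {i k} → Mirror i k → Mirror k i
  mirror-sym {i} {k} (mirror e) = mirror (trans (cong suc (+-comm k i)) e)

  mirror-unique : ∀ {i k k′} → Mirror i k → Mirror i k′ → k ≡ k′
  mirror-unique {i} (mirror e) (mirror e′) = +-cancelˡ-≡ i _ _ (suc-injective (trans e (sym e′)))

  mirror-unique₁ : ∀ {i i′ k} → Mirror i k → Mirror i′ k → i ≡ i′
  mirror-unique₁ e e′ = mirror-unique (mirror-sym e) (mirror-sym e′)

  mirror-antitone : ∀ {i k j l} → Mirror i k → Mirror j l → i < j → l < k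
  mirror-antitone {i} {k} {j} {l} (mirror e) (mirror e′) i<j with <-cmp l k
  ... | tri< l<k _ _ = l<k
  ... | tri≈ _ refl _ = ⊥-elim (<-irrefl (mirror-unique₁ (mirror e) (mirror e′)) i<j)
  ... | tri> _ _ k<l = ⊥-elim (<-irrefl (suc-injective (trans e (sym e′))) (+-mono-< i<j k<l))

  mirror-< : ∀ {i k} → Mirror i k → k < N
  mirror-< {i} {k} (mirror e) = subst (k <_) e (s≤s (m≤n+m k i))

  mirror-<₁ : ∀ {i k} → Mirror i k → i < N
  mirror-<₁ e = mirror-< (mirror-sym e)

  mirror-suc : ∀ {i k} → Mirror i (suc k) → Mirror (suc i) k
  mirror-suc {i} {k} (mirror e) = mirror (trans (cong suc (sym (+-suc i k))) e)

  -- The pair of positions mirroring t, t + 1 is mirrorPos t + 1, mirrorPos t.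
  mirrorPos : ℕ → ℕ
  mirrorPos t = N ∸ suc (suc t)

  mirror-mirrorPos : ∀ {t} → suc t < N → Mirror t (suc (mirrorPos t))
  mirror-mirrorPos {t} h = mirror (begin
    suc (t + suc m)     ≡⟨ cong suc (+-suc t m) ⟩
    suc (suc (t + m))   ≡⟨ cong (λ q → suc (suc q)) (+-comm t m) ⟩
    suc (suc (m + t))   ≡⟨ cong suc (+-suc m t) ⟨
    suc (m + suc t)     ≡⟨ +-suc m (suc t) ⟨
    m + suc (suc t)     ≡⟨ m∸n+n≡m h ⟩
    N                   ∎)
    where
    open ≡-Reasoning
    m : ℕ
    m = mirrorPos t

  -- Both by parity: N = n + n is even.
  1+t≢mirrorPos : ∀ {t} → suc t < N → suc t ≢ mirrorPos t
  1+t≢mirrorPos {t} h e with mirror-mirrorPos h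
  ... | mirror q = odd≢even (suc t) n (trans (cong suc (sym (+-suc t (suc t)))) (trans (cong (λ z → suc (t + suc z)) e) q))

  t≢1+mirrorPos : ∀ {t} → suc t < N → t ≢ suc (mirrorPos t)
  t≢1+mirrorPos {t} h e with mirror-mirrorPos h
  ... | mirror q = odd≢even t n (trans (cong (λ z → suc (t + z)) e) q)

  complement : ℕ → ℕ
  complement u = suc N ∸ u

  Adjacent : List ℕ → ℕ → ℕ → Set
  Adjacent l u v = ∃[ k ] (suc k < N × nth l k ≡ u × nth l (suc k) ≡ v)

  adjacent? : ∀ l u v → Dec (Adjacent l u v)
  adjacent? l u v with anyUpTo? (λ k → (suc k <? N) ×-dec ((nth l k ≟ u) ×-dec (nth l (suc k) ≟ v))) N
  ... | yes (k , _ , adj) = yes (k , adj)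
  ... | no none = no λ (k , adj@(1+k< , _)) → none (k , <-trans (n<1+n k) 1+k< , adj)

  record SignedPerm (l : List ℕ) : Set where
    field
      length-≡ : length l ≡ N
      injective : NthInjective l
      permutation : l ↭ range N
      signed : IsSigned n l

  B⇒SignedPerm : ∀ {l} → B n l → SignedPerm l
  B⇒SignedPerm {l} (p , s) = record
    { length-≡ = trans (↭-length p) (trans (length-map suc (upTo N)) (length-upTo N))
    ; injective = unique⇒nthInjective l (↭range⇒unique p)
    ; permutation = p
    ; signed = s
    }

  SignedPerm⇒B : ∀ {l} → SignedPerm l → B n l
  SignedPerm⇒B sp = SignedPerm.permutation sp , SignedPerm.signed sp

  module SignedPermProperties {l : List ℕ} (sp : SignedPerm l) where
    open SignedPerm sp

    <N⇒<length : ∀ {i} → i < N → i < length l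
    <N⇒<length = subst (_ <_) (sym length-≡)

    <length⇒<N : ∀ {i} → i < length l → i < N
    <length⇒<N = subst (_ <_) length-≡

    nth-injective′ : ∀ {i j} → i < N → j < N → nth l i ≡ nth l j → i ≡ j
    nth-injective′ i< j< = nth-injective injective (<N⇒<length i<) (<N⇒<length j<)

    occurs-nth : ∀ {i} → i < N → Occurs l (nth l i)
    occurs-nth i< = _ , <N⇒<length i< , refl

    position : ∀ {u} → Occurs l u → ∃[ π ] (π < N × nth l π ≡ u)
    position (π , π< , e) = π , <length⇒<N π< , e

    precedes-at : ∀ {i j u v} → i < j → j < N → nth l i ≡ u → nth l j ≡ v → Precedes l u v
    precedes-at i<j j< e₁ e₂ = _ , _ , i<j , <N⇒<length j< , e₁ , e₂

    precedes-nth : ∀ {i j} → i < j → j < N → Precedes l (nth l i) (nth l j)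
    precedes-nth i<j j< = precedes-at i<j j< refl refl

    precedes⇒< : ∀ {i j u v} → i < N → j < N → nth l i ≡ u → nth l j ≡ v → Precedes l u v → i < j
    precedes⇒< i< j< refl refl (a , b , a<b , b< , e₁ , e₂) =
      subst₂ _<_ (nth-injective′ (<-trans a<b (<length⇒<N b<)) i< e₁) (nth-injective′ (<length⇒<N b<) j< e₂) a<b

    nth-mirror-sum : ∀ {i k} → Mirror i k → nth l i + nth l k ≡ suc N
    nth-mirror-sum {i} e = subst (λ z → nth l i + nth l z ≡ suc N) (mirror-index e) (signed i (mirror-<₁ e))

    nth-mirror : ∀ {i k} → Mirror i k → nth l k ≡ complement (nth l i)
    nth-mirror {i} {k} e = trans (sym (m+n∸m≡n (nth l i) (nth l k))) (cong (_∸ nth l i) (nth-mirror-sum e))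

    complement-involutive : ∀ {u} → Occurs l u → complement (complement u) ≡ u
    complement-involutive (i , i< , refl) = trans (cong complement (sym (nth-mirror e))) (sym (nth-mirror (mirror-sym e)))
      where
      e : Mirror i (N ∸ suc i)
      e = mirror-of (<length⇒<N i<)

    occurs⇒≤ : ∀ {u} → Occurs l u → u ≤ suc N
    occurs⇒≤ (i , i< , refl) = subst (nth l i ≤_) (nth-mirror-sum (mirror-of (<length⇒<N i<))) (m≤m+n _ _)

    precedes-complement : ∀ {u v} → Precedes l u v → Precedes l (complement v) (complement u)
    precedes-complement (i , j , i<j , j< , refl , refl) =
      N ∸ suc j , N ∸ suc i , mirror-antitone eᵢ eⱼ i<j , <N⇒<length (mirror-< eᵢ) , nth-mirror eⱼ , nth-mirror eᵢ
      where
      eᵢ : Mirror i (N ∸ suc i)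
      eᵢ = mirror-of (<length⇒<N (<-trans i<j j<))
      eⱼ : Mirror j (N ∸ suc j)
      eⱼ = mirror-of (<length⇒<N j<)

    adjacent-complement : ∀ {u v} → Adjacent l u v → Adjacent l (complement v) (complement u)
    adjacent-complement (k , 1+k< , refl , refl) =
      mirrorPos k , mirror-< (mirror-mirrorPos 1+k<) ,
      nth-mirror (mirror-suc (mirror-mirrorPos 1+k<)) , nth-mirror (mirror-mirrorPos 1+k<)

    inversion-complement : ∀ {a b} → Inv l a b → Inv l (complement b) (complement a)
    inversion-complement (a<b , b≺a) =
      ∸-monoʳ-< a<b (occurs⇒≤ (precedes⇒occurs₁ {l} b≺a)) , precedes-complement b≺a

  -- Swapping positions t, t + 1 and the mirror pair; index i is the position in l of the i-th letter of word.
  record SignedSwap (l : List ℕ) (t : ℕ) : Set where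
    field
      word : List ℕ
      length-word : length word ≡ length l
      word-↭ : word ↭ l
      index : ℕ → ℕ
      nth-word : ∀ i → nth word i ≡ nth l (index i)
      index-< : ∀ {i} → i < N → index i < N
      index-mono-< : ∀ {i j} → i < j → ¬ (i ≡ t × j ≡ suc t) → ¬ (i ≡ mirrorPos t × j ≡ suc (mirrorPos t)) →
                     index i < index j
      index-t : index t ≡ suc t
      index-1+t : index (suc t) ≡ t
      index-m : index (mirrorPos t) ≡ suc (mirrorPos t)
      index-1+m : index (suc (mirrorPos t)) ≡ mirrorPos t
      index-other : ∀ {i} → i ≢ t → i ≢ suc t → i ≢ mirrorPos t → i ≢ suc (mirrorPos t) → index i ≡ i

  signedSwap : ∀ l t → length l ≡ N → suc t < N → SignedSwap l t
  signedSwap l t len h with t ≟ mirrorPos t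
  ... | yes t≡m = record
      { word = swapAt t l
      ; length-word = length-swapAt t l
      ; word-↭ = swapAt-↭ t l
      ; index = swapIndex t
      ; nth-word = nth-swapAt t l (subst (suc t <_) (sym len) h)
      ; index-< = swapIndex-< t _ N h
      ; index-mono-< = λ i<j ≢t _ → swapIndex-mono-< t _ _ i<j ≢t
      ; index-t = swapIndex-left t
      ; index-1+t = swapIndex-right t
      ; index-m = subst (λ q → swapIndex t q ≡ suc q) t≡m (swapIndex-left t)
      ; index-1+m = subst (λ q → swapIndex t (suc q) ≡ q) t≡m (swapIndex-right t)
      ; index-other = λ ≢t ≢1+t _ _ → swapIndex-other t _ ≢t ≢1+t
      }
  ... | no t≢m = record
      { word = swapAt t (swapAt m l)
      ; length-word = trans (length-swapAt t (swapAt m l)) (length-swapAt m l)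
      ; word-↭ = ↭-trans (swapAt-↭ t (swapAt m l)) (swapAt-↭ m l)
      ; index = λ i → swapIndex m (swapIndex t i)
      ; nth-word = λ i → trans (nth-swapAt t (swapAt m l) (subst (suc t <_) (sym (trans (length-swapAt m l) len)) h) i)
                               (nth-swapAt m l (subst (suc m <_) (sym len) 1+m<) (swapIndex t i))
      ; index-< = λ i< → swapIndex-< m _ N 1+m< (swapIndex-< t _ N h i<)
      ; index-mono-< = mono
      ; index-t = trans (cong (swapIndex m) (swapIndex-left t)) (swapIndex-other m (suc t) d₁ (λ e → t≢m (suc-injective e)))
      ; index-1+t = trans (cong (swapIndex m) (swapIndex-right t)) (swapIndex-other m t t≢m d₂)
      ; index-m = trans (cong (swapIndex m) (m-fixed-by-t)) (swapIndex-left m)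
      ; index-1+m = trans (cong (swapIndex m) 1+m-fixed-by-t) (swapIndex-right m)
      ; index-other = λ a b c d → trans (cong (swapIndex m) (swapIndex-other t _ a b)) (swapIndex-other m _ c d)
      }
    where
    m : ℕ
    m = mirrorPos t
    1+m< : suc m < N
    1+m< = mirror-< (mirror-mirrorPos h)
    d₁ : suc t ≢ m
    d₁ = 1+t≢mirrorPos h
    d₂ : t ≢ suc m
    d₂ = t≢1+mirrorPos h
    m-fixed-by-t : swapIndex t m ≡ m
    m-fixed-by-t = swapIndex-other t m (λ e → t≢m (sym e)) (λ e → d₁ (sym e))
    1+m-fixed-by-t : swapIndex t (suc m) ≡ suc m
    1+m-fixed-by-t = swapIndex-other t (suc m) (λ e → d₂ (sym e)) (λ e → t≢m (sym (suc-injective e)))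
    mono : ∀ {i j} → i < j → ¬ (i ≡ t × j ≡ suc t) → ¬ (i ≡ m × j ≡ suc m) →
           swapIndex m (swapIndex t i) < swapIndex m (swapIndex t j)
    mono {i} {j} i<j ≢t ≢m = swapIndex-mono-< m _ _ (swapIndex-mono-< t i j i<j ≢t)
      λ (a , b) → ≢m ( trans (sym (swapIndex-involutive t i)) (trans (cong (swapIndex t) a) m-fixed-by-t)
                     , trans (sym (swapIndex-involutive t j)) (trans (cong (swapIndex t) b) 1+m-fixed-by-t))

  module SignedSwapProperties {l : List ℕ} (sp : SignedPerm l) {t : ℕ} (h : suc t < N) (S : SignedSwap l t) where
    open SignedSwap S
    open SignedPerm sp
    private module L = SignedPermProperties sp

    m : ℕ
    m = mirrorPos t

    mirror-t : Mirror t (suc m)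
    mirror-t = mirror-mirrorPos h

    mirror-1+t : Mirror (suc t) m
    mirror-1+t = mirror-suc mirror-t

    index-involutive : ∀ i → index (index i) ≡ i
    index-involutive i with i ≟ t | i ≟ suc t | i ≟ m | i ≟ suc m
    ... | yes refl | _ | _ | _ = trans (cong index index-t) index-1+t
    ... | no _ | yes refl | _ | _ = trans (cong index index-1+t) index-t
    ... | no _ | no _ | yes refl | _ = trans (cong index index-m) index-1+m
    ... | no _ | no _ | no _ | yes refl = trans (cong index index-1+m) index-m
    ... | no a | no b | no c | no d = trans (cong index (index-other a b c d)) (index-other a b c d)

    index-mirror : ∀ {i k} → Mirror i k → Mirror (index i) (index k)
    index-mirror {i} {k} e with i ≟ t | i ≟ suc t | i ≟ m | i ≟ suc m
    ... | yes refl | _ | _ | _ rewrite mirror-unique e mirror-t = subst₂ Mirror (sym index-t) (sym index-1+m) mirror-1+t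
    ... | no _ | yes refl | _ | _ rewrite mirror-unique e mirror-1+t = subst₂ Mirror (sym index-1+t) (sym index-m) mirror-t
    ... | no _ | no _ | yes refl | _ rewrite mirror-unique e (mirror-sym mirror-1+t) =
      subst₂ Mirror (sym index-m) (sym index-1+t) (mirror-sym mirror-t)
    ... | no _ | no _ | no _ | yes refl rewrite mirror-unique e (mirror-sym mirror-t) =
      subst₂ Mirror (sym index-1+m) (sym index-t) (mirror-sym mirror-1+t)
    ... | no a | no b | no c | no d =
      subst₂ Mirror (sym (index-other a b c d)) (sym (index-other
        (λ q → d (mirror-unique₁ e (subst (Mirror (suc m)) (sym q) (mirror-sym mirror-t))))
        (λ q → c (mirror-unique₁ e (subst (Mirror m) (sym q) (mirror-sym mirror-1+t))))
        (λ q → b (mirror-unique₁ e (subst (Mirror (suc t)) (sym q) mirror-1+t)))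
        (λ q → a (mirror-unique₁ e (subst (Mirror t) (sym q) mirror-t))))) e

    length-word≡N : length word ≡ N
    length-word≡N = trans length-word length-≡

    word-signedPerm : SignedPerm word
    word-signedPerm = record
      { length-≡ = length-word≡N
      ; injective = record { nth-injective = λ {i} {j} i< j< e →
          trans (sym (index-involutive i))
            (trans (cong index (L.nth-injective′ (index-< (subst (i <_) length-word≡N i<)) (index-< (subst (j <_) length-word≡N j<))
                                                 (trans (sym (nth-word i)) (trans e (nth-word j)))))
                   (index-involutive j)) }
      ; permutation = ↭-trans word-↭ permutation
      ; signed = λ i i< → trans (cong₂ _+_ (nth-word i) (nth-word (N ∸ suc i))) (L.nth-mirror-sum (index-mirror (mirror-of i<)))
      }

    precedes-swap : ∀ {u v} → Precedes l u v → ¬ (u ≡ nth l t × v ≡ nth l (suc t)) →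
                    ¬ (u ≡ nth l m × v ≡ nth l (suc m)) → Precedes word u v
    precedes-swap (a , b , a<b , b< , refl , refl) ≢t ≢m =
      index a , index b ,
      index-mono-< a<b (λ { (refl , refl) → ≢t (refl , refl) }) (λ { (refl , refl) → ≢m (refl , refl) }) ,
      subst (index b <_) (sym length-word≡N) (index-< (L.<length⇒<N b<)) ,
      trans (nth-word (index a)) (cong (nth l) (index-involutive a)) ,
      trans (nth-word (index b)) (cong (nth l) (index-involutive b))

    precedes-unswap : ∀ {u v} → Precedes word u v →
                      Precedes l u v ⊎ ((u ≡ nth l (suc t) × v ≡ nth l t) ⊎ (u ≡ nth l (suc m) × v ≡ nth l m))
    precedes-unswap (a , b , a<b , b< , refl , refl) with (a ≟ t) ×-dec (b ≟ suc t)
    ... | yes (refl , refl) = inj₂ (inj₁ (trans (nth-word t) (cong (nth l) index-t) , trans (nth-word (suc t)) (cong (nth l) index-1+t)))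
    ... | no ≢t with (a ≟ m) ×-dec (b ≟ suc m)
    ...   | yes (refl , refl) = inj₂ (inj₂ (trans (nth-word m) (cong (nth l) index-m) , trans (nth-word (suc m)) (cong (nth l) index-1+m)))
    ...   | no ≢m = inj₁ (index a , index b , index-mono-< a<b ≢t ≢m ,
                         L.<N⇒<length (index-< (subst (b <_) length-word≡N b<)) , sym (nth-word a) , sym (nth-word b))

    swapped-pair-precedes : Precedes word (nth l (suc t)) (nth l t)
    swapped-pair-precedes =
      t , suc t , ≤-refl , subst (suc t <_) (sym length-word≡N) h ,
      trans (nth-word t) (cong (nth l) index-t) , trans (nth-word (suc t)) (cong (nth l) index-1+t)

    nth-m : nth l m ≡ complement (nth l (suc t))
    nth-m = L.nth-mirror mirror-1+t

    nth-1+m : nth l (suc m) ≡ complement (nth l t)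
    nth-1+m = L.nth-mirror mirror-t

  occurs-transfer : ∀ {a b u} → SignedPerm a → SignedPerm b → Occurs a u → Occurs b u
  occurs-transfer {a} {b} sa sb o =
    ∈⇒occurs b (∈-resp-↭ (↭-sym (SignedPerm.permutation sb)) (∈-resp-↭ (SignedPerm.permutation sa) (occurs⇒∈ a o)))

  module _ {w z : List ℕ} (sw : SignedPerm w) (sz : SignedPerm z) (w≤z : w ≤w z) (z≤w : z ≤w w) where
    private
      injw : NthInjective w
      injw = SignedPerm.injective sw
      injz : NthInjective z
      injz = SignedPerm.injective sz
      module W = SignedPermProperties sw
      module Z = SignedPermProperties sz

    precedes-transfer : ∀ {u v} → Precedes w u v → Precedes z u v
    precedes-transfer {u} {v} u≺v with <-cmp u v
    ... | tri≈ _ refl _ = ⊥-elim (precedes-irrefl injw u≺v)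
    ... | tri> _ _ v<u = proj₂ (w≤z v u (v<u , u≺v))
    ... | tri< u<v _ _
      with precedes-total injz (occurs-transfer sw sz (precedes⇒occurs₁ {w} u≺v))
                               (occurs-transfer sw sz (precedes⇒occurs₂ {w} u≺v)) (<⇒≢ u<v)
    ...   | inj₁ u≺v′ = u≺v′
    ...   | inj₂ v≺u = ⊥-elim (precedes-asym injw u≺v (proj₂ (z≤w u v (u<v , v≺u))))

    private
      agree-at : ∀ i → (∀ k → k < i → nth w k ≡ nth z k) → i < N → nth w i ≡ nth z i
      agree-at i agree i< with nth w i ≟ nth z i
      ... | yes e = e
      ... | no wᵢ≢zᵢ with Z.position (occurs-transfer sw sz (W.occurs-nth i<))
                        | W.position (occurs-transfer sz sw (Z.occurs-nth i<))
      ...   | (j , j< , eⱼ) | (j′ , j′< , eⱼ′) with <-cmp j i | <-cmp j′ i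
      ...     | tri< j<i _ _ | _ = ⊥-elim (<-irrefl (W.nth-injective′ (<-trans j<i i<) i< (trans (agree j j<i) eⱼ)) j<i)
      ...     | tri≈ _ refl _ | _ = ⊥-elim (wᵢ≢zᵢ (sym eⱼ))
      ...     | tri> _ _ _ | tri< j′<i _ _ = ⊥-elim (<-irrefl (Z.nth-injective′ (<-trans j′<i i<) i< (trans (sym (agree j′ j′<i)) eⱼ′)) j′<i)
      ...     | tri> _ _ _ | tri≈ _ refl _ = ⊥-elim (wᵢ≢zᵢ eⱼ′)
      ...     | tri> _ _ i<j | tri> _ _ i<j′ =
        ⊥-elim (precedes-asym injz (Z.precedes-at i<j j< refl eⱼ) (precedes-transfer (W.precedes-at i<j′ j′< refl eⱼ′)))

      agree-below : ∀ i → i ≤ N → ∀ k → k < i → nth w k ≡ nth z k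
      agree-below zero _ k ()
      agree-below (suc i) 1+i≤N k k<1+i with m≤n⇒m<n∨m≡n (≤-pred k<1+i)
      ... | inj₁ k<i = agree-below i (<⇒≤ 1+i≤N) k k<i
      ... | inj₂ refl = agree-at k (agree-below k (<⇒≤ 1+i≤N)) 1+i≤N

    sameInversions⇒≡ : w ≡ z
    sameInversions⇒≡ = nth-extensionality w z (trans (SignedPerm.length-≡ sw) (sym (SignedPerm.length-≡ sz)))
      λ i i< → agree-below N ≤-refl i (W.<length⇒<N i<)

-- Covers in the weak order

module Covers (n : ℕ) where
  open SignedPermutations n

  swapWord : ∀ {y} → SignedPerm y → ∀ {t} → suc t < N → List ℕ
  swapWord {y} sy {t} h = SignedSwap.word (signedSwap y t (SignedPerm.length-≡ sy) h)

  DescentSwapOf : ∀ {y} → SignedPerm y → List ℕ → Set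
  DescentSwapOf {y} sy s = ∃[ t ] Σ (suc t < N) λ h → nth y (suc t) < nth y t × s ≡ swapWord sy h

  module DescentSwap {y : List ℕ} (sy : SignedPerm y) {t : ℕ} (h : suc t < N) (desc : nth y (suc t) < nth y t) where
    S : SignedSwap y t
    S = signedSwap y t (SignedPerm.length-≡ sy) h
    open SignedSwap S using () renaming (word to z) public
    open SignedSwapProperties sy h S public
    private
      module Y = SignedPermProperties sy
      injy : NthInjective y
      injy = SignedPerm.injective sy

    yₜ≺yₜ₊₁ : Precedes y (nth y t) (nth y (suc t))
    yₜ≺yₜ₊₁ = Y.precedes-nth ≤-refl h

    occurs-yₜ : Occurs y (nth y t)
    occurs-yₜ = precedes⇒occurs₁ {y} yₜ≺yₜ₊₁

    occurs-yₜ₊₁ : Occurs y (nth y (suc t))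
    occurs-yₜ₊₁ = precedes⇒occurs₂ {y} yₜ≺yₜ₊₁

    precedes-mirrorPair : ∀ {w} → SignedPerm w → Precedes w (nth y m) (nth y (suc m)) → Precedes w (nth y t) (nth y (suc t))
    precedes-mirrorPair {w} sw p =
      subst₂ (Precedes w) (W.complement-involutive (occurs-transfer sy sw occurs-yₜ))
                          (W.complement-involutive (occurs-transfer sy sw occurs-yₜ₊₁))
        (W.precedes-complement (subst₂ (Precedes w) nth-m nth-1+m p))
      where module W = SignedPermProperties sw

    swap-≤ : z ≤w y
    swap-≤ a b (a<b , b≺a) with precedes-unswap b≺a
    ... | inj₁ b≺a′ = a<b , b≺a′
    ... | inj₂ (inj₁ (refl , refl)) = ⊥-elim (<-asym a<b desc)
    ... | inj₂ (inj₂ (refl , refl)) =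
      ⊥-elim (<-asym a<b (subst₂ _<_ (sym nth-1+m) (sym nth-m) (∸-monoʳ-< desc (Y.occurs⇒≤ occurs-yₜ))))

    swap-≢ : z ≢ y
    swap-≢ e = precedes-asym injy yₜ≺yₜ₊₁ (subst (λ q → Precedes q (nth y (suc t)) (nth y t)) e swapped-pair-precedes)

    inversion-swap : ∀ {a b} → Inv y a b → ¬ (b ≡ nth y t × a ≡ nth y (suc t)) →
                     ¬ (b ≡ nth y m × a ≡ nth y (suc m)) → Inv z a b
    inversion-swap (a<b , b≺a) ≢t ≢m = a<b , precedes-swap b≺a ≢t ≢m

    -- z lacks exactly the inversion (yₜ₊₁, yₜ) of y and its mirror, so any w in between has either both or neither.
    swap-covered : Covered n z y
    swap-covered = SignedPerm⇒B word-signedPerm , swap-≤ , swap-≢ , between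
      where
      between : ∀ w → B n w → z ≤w w → w ≤w y → w ≡ z ⊎ w ≡ y
      between w bw z≤w w≤y
        with precedes? (SignedPerm.injective (B⇒SignedPerm bw)) (occurs-transfer sy (B⇒SignedPerm bw) occurs-yₜ)
                                                               (occurs-transfer sy (B⇒SignedPerm bw) occurs-yₜ₊₁)
      ... | yes yₜ≺yₜ₊₁′ = inj₂ (sameInversions⇒≡ sw sy w≤y y≤w)
        where
        sw : SignedPerm w
        sw = B⇒SignedPerm bw
        y≤w : y ≤w w
        y≤w a b inv with (b ≟ nth y t) ×-dec (a ≟ nth y (suc t))
        ... | yes (refl , refl) = proj₁ inv , yₜ≺yₜ₊₁′
        ... | no ≢t with (b ≟ nth y m) ×-dec (a ≟ nth y (suc m))
        ...   | yes (refl , refl) =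
          subst₂ (Inv w) (sym nth-1+m) (sym nth-m) (SignedPermProperties.inversion-complement sw (desc , yₜ≺yₜ₊₁′))
        ...   | no ≢m = z≤w a b (inversion-swap inv ≢t ≢m)
      ... | no ¬yₜ≺yₜ₊₁ = inj₁ (sameInversions⇒≡ sw word-signedPerm w≤z z≤w)
        where
        sw : SignedPerm w
        sw = B⇒SignedPerm bw
        w≤z : w ≤w z
        w≤z a b inv = inversion-swap (w≤y a b inv)
          (λ { (refl , refl) → ¬yₜ≺yₜ₊₁ (proj₂ inv) })
          (λ { (refl , refl) → ¬yₜ≺yₜ₊₁ (precedes-mirrorPair sw (proj₂ inv)) })

  module CoveredBy {y : List ℕ} (sy : SignedPerm y) {s : List ℕ} (cov : Covered n s y) where
    private
      ss : SignedPerm s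
      ss = B⇒SignedPerm (proj₁ cov)
      s≤y : s ≤w y
      s≤y = proj₁ (proj₂ cov)
      s≢y : s ≢ y
      s≢y = proj₁ (proj₂ (proj₂ cov))
      injy : NthInjective y
      injy = SignedPerm.injective sy
      injs : NthInjective s
      injs = SignedPerm.injective ss
      module Y = SignedPermProperties sy

      occurs-s : ∀ {i} → i < N → Occurs s (nth y i)
      occurs-s i< = occurs-transfer sy ss (Y.occurs-nth i<)

      inversion-y : ∀ {a b} → a < b → Precedes s b a → Precedes y b a
      inversion-y a<b b≺a = proj₂ (s≤y _ _ (a<b , b≺a))

      Undone : ℕ → ℕ → Set
      Undone i j = i < N × j < N × i < j × nth y j < nth y i × Precedes s (nth y j) (nth y i)

      undone? : ∀ i j → Dec (Undone i j)
      undone? i j with i <? N | j <? N | i <? j | nth y j <? nth y i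
      ... | no i≮N | _ | _ | _ = no λ u → i≮N (proj₁ u)
      ... | yes _ | no j≮N | _ | _ = no λ u → j≮N (proj₁ (proj₂ u))
      ... | yes _ | yes _ | no i≮j | _ = no λ u → i≮j (proj₁ (proj₂ (proj₂ u)))
      ... | yes _ | yes _ | yes _ | no ¬desc = no λ u → ¬desc (proj₁ (proj₂ (proj₂ (proj₂ u))))
      ... | yes i< | yes j< | yes i<j | yes desc with precedes? injs (occurs-s j<) (occurs-s i<)
      ...   | yes yⱼ≺yᵢ = yes (i< , j< , i<j , desc , yⱼ≺yᵢ)
      ...   | no ¬yⱼ≺yᵢ = no λ u → ¬yⱼ≺yᵢ (proj₂ (proj₂ (proj₂ (proj₂ u))))

      undone-exists : ∃[ i ] ∃[ j ] Undone i j
      undone-exists with anyUpTo? (λ i → anyUpTo? (undone? i) N) N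
      ... | yes (i , _ , j , _ , u) = i , j , u
      ... | no none = ⊥-elim (s≢y (sameInversions⇒≡ ss sy s≤y y≤s))
        where
        y≤s : y ≤w s
        y≤s a b (a<b , (i , j , i<j , j< , refl , refl))
          with precedes? injs (occurs-s (Y.<length⇒<N (<-trans i<j j<))) (occurs-s (Y.<length⇒<N j<))
        ... | yes yᵢ≺yⱼ = a<b , yᵢ≺yⱼ
        ... | no ¬yᵢ≺yⱼ with precedes-total injs (occurs-s (Y.<length⇒<N j<)) (occurs-s (Y.<length⇒<N (<-trans i<j j<))) (<⇒≢ a<b)
        ...   | inj₁ yⱼ≺yᵢ = ⊥-elim (none (i , Y.<length⇒<N (<-trans i<j j<) , j , Y.<length⇒<N j< ,
                                            Y.<length⇒<N (<-trans i<j j<) , Y.<length⇒<N j< , i<j , a<b , yⱼ≺yᵢ))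
        ...   | inj₂ yᵢ≺yⱼ = ⊥-elim (¬yᵢ≺yⱼ yᵢ≺yⱼ)

      -- Walking from i towards j, the undone inversion can be pushed onto an adjacent pair,
      -- since s ≤ y forbids s to create inversions.
      undone-adjacent : ∀ d i j → j ≡ suc (i + d) → Undone i j → ∃[ t ] Undone t (suc t)
      undone-step : ∀ d i j → j ≡ suc (suc i + d) → suc i < j → Undone i j → ∃[ t ] Undone t (suc t)

      undone-adjacent zero i j e u rewrite e | +-identityʳ i = i , u
      undone-adjacent (suc d) i j e u = undone-step d i j (trans e (cong suc (+-suc i d))) 1+i<j u
        where
        1+i<j : suc i < j
        1+i<j = subst (suc i <_) (sym e) (s≤s (subst (i <_) (sym (+-suc i d)) (s≤s (m≤m+n i d))))

      undone-step d i j e 1+i<j (i< , j< , i<j , yⱼ<yᵢ , yⱼ≺yᵢ) with <-cmp (nth y (suc i)) (nth y i)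
      ... | tri≈ _ eq _ = ⊥-elim (<-irrefl (sym (Y.nth-injective′ (<-trans 1+i<j j<) i< eq)) (n<1+n i))
      ... | tri< yᵢ₊₁<yᵢ _ _ with precedes? injs (occurs-s (<-trans 1+i<j j<)) (occurs-s i<)
      ...   | yes yᵢ₊₁≺yᵢ = i , (i< , <-trans 1+i<j j< , n<1+n i , yᵢ₊₁<yᵢ , yᵢ₊₁≺yᵢ)
      ...   | no ¬yᵢ₊₁≺yᵢ with precedes-total injs (occurs-s i<) (occurs-s (<-trans 1+i<j j<)) (λ q → <-irrefl (sym q) yᵢ₊₁<yᵢ)
      ...     | inj₂ yᵢ₊₁≺yᵢ = ⊥-elim (¬yᵢ₊₁≺yᵢ yᵢ₊₁≺yᵢ)
      ...     | inj₁ yᵢ≺yᵢ₊₁ with <-cmp (nth y j) (nth y (suc i))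
      ...       | tri< yⱼ<yᵢ₊₁ _ _ =
        undone-adjacent d (suc i) j e (<-trans 1+i<j j< , j< , 1+i<j , yⱼ<yᵢ₊₁ , precedes-trans injs yⱼ≺yᵢ yᵢ≺yᵢ₊₁)
      ...       | tri≈ _ eq _ = ⊥-elim (<-irrefl (Y.nth-injective′ (<-trans 1+i<j j<) j< (sym eq)) 1+i<j)
      ...       | tri> _ _ yᵢ₊₁<yⱼ = ⊥-elim (precedes-asym injy (inversion-y yᵢ₊₁<yⱼ (precedes-trans injs yⱼ≺yᵢ yᵢ≺yᵢ₊₁))
                                                            (Y.precedes-nth 1+i<j j<))
      undone-step d i j e 1+i<j (i< , j< , i<j , yⱼ<yᵢ , yⱼ≺yᵢ) | tri> _ _ yᵢ<yᵢ₊₁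
        with precedes? injs (occurs-s j<) (occurs-s (<-trans 1+i<j j<))
      ... | yes yⱼ≺yᵢ₊₁ = undone-adjacent d (suc i) j e (<-trans 1+i<j j< , j< , 1+i<j , <-trans yⱼ<yᵢ yᵢ<yᵢ₊₁ , yⱼ≺yᵢ₊₁)
      ... | no ¬yⱼ≺yᵢ₊₁ with precedes-total injs (occurs-s j<) (occurs-s (<-trans 1+i<j j<)) (λ q → <-irrefl q (<-trans yⱼ<yᵢ yᵢ<yᵢ₊₁))
      ...   | inj₁ yⱼ≺yᵢ₊₁ = ⊥-elim (¬yⱼ≺yᵢ₊₁ yⱼ≺yᵢ₊₁)
      ...   | inj₂ yᵢ₊₁≺yⱼ = ⊥-elim (precedes-asym injy (inversion-y yᵢ<yᵢ₊₁ (precedes-trans injs yᵢ₊₁≺yⱼ yⱼ≺yᵢ))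
                                                      (Y.precedes-nth (n<1+n i) (<-trans 1+i<j j<)))

    covered⇒descentSwap : DescentSwapOf sy s
    covered⇒descentSwap with undone-exists
    ... | i , j , u@(_ , _ , i<j , _) with undone-adjacent (j ∸ suc i) i j (sym (m+[n∸m]≡n i<j)) u
    ...   | t , (_ , h , _ , desc , yₜ₊₁≺yₜ) = t , h , desc , s≡z
      where
      open DescentSwap sy h desc
      s≤z : s ≤w z
      s≤z a b inv = inversion-swap (s≤y a b inv)
        (λ { (refl , refl) → precedes-asym injs (proj₂ inv) yₜ₊₁≺yₜ })
        (λ { (refl , refl) → precedes-asym injs (precedes-mirrorPair ss (proj₂ inv)) yₜ₊₁≺yₜ })
      s≡z : s ≡ z
      s≡z with proj₂ (proj₂ (proj₂ cov)) z (SignedPerm⇒B word-signedPerm) s≤z swap-≤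
      ... | inj₁ z≡s = sym z≡s
      ... | inj₂ z≡y = ⊥-elim (swap-≢ z≡y)

    nonadjacentInversion-kept : ∀ {a b} → Inv y a b → ¬ Adjacent y b a → Inv s a b
    nonadjacentInversion-kept {a} {b} inv ¬adj = kept covered⇒descentSwap
      where
      kept : DescentSwapOf sy s → Inv s a b
      kept (t , h , desc , s≡z) = subst (λ s′ → Inv s′ a b) (sym s≡z) (D.inversion-swap inv not-pair not-mirror)
        where
        module D = DescentSwap sy h desc
        not-pair : ¬ (b ≡ nth y t × a ≡ nth y (suc t))
        not-pair (e₁ , e₂) = ¬adj (t , h , sym e₁ , sym e₂)
        not-mirror : ¬ (b ≡ nth y D.m × a ≡ nth y (suc D.m))
        not-mirror (e₁ , e₂) = ¬adj (D.m , mirror-< D.mirror-t , sym e₁ , sym e₂)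

-- Consequences of x = Pop(y)

module PopImage (n : ℕ) {x y : List ℕ} (Bx : B n x) (By : B n y) (pop : IsPopOf n y x) where
  open SignedPermutations n
  open Covers n

  sx : SignedPerm x
  sx = B⇒SignedPerm Bx
  sy : SignedPerm y
  sy = B⇒SignedPerm By
  module X = SignedPermProperties sx
  module Y = SignedPermProperties sy
  injx : NthInjective x
  injx = SignedPerm.injective sx
  injy : NthInjective y
  injy = SignedPerm.injective sy

  Covering : List ℕ → Set
  Covering s = s ≡ y ⊎ Covered n s y

  pop-lower : ∀ s → Covering s → x ≤w s
  pop-lower = proj₁ (proj₂ pop)

  pop-greatest : ∀ w → B n w → (∀ s → Covering s → w ≤w s) → w ≤w x
  pop-greatest = proj₂ (proj₂ pop)

  pop-≤ : x ≤w y
  pop-≤ = pop-lower y (inj₁ refl)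

  positionInY : ∀ {i} → i < N → ∃[ π ] (π < N × nth y π ≡ nth x i)
  positionInY i< = Y.position (occurs-transfer sx sy (X.occurs-nth i<))

  yPos : ∀ {q} → q < N → ℕ
  yPos q< = proj₁ (positionInY q<)

  yPos-< : ∀ {q} (q< : q < N) → yPos q< < N
  yPos-< q< = proj₁ (proj₂ (positionInY q<))

  nth-yPos : ∀ {q} (q< : q < N) → nth y (yPos q<) ≡ nth x q
  nth-yPos q< = proj₂ (proj₂ (positionInY q<))

  positionInX : ∀ {i} → i < N → ∃[ π ] (π < N × nth x π ≡ nth y i)
  positionInX i< = X.position (occurs-transfer sy sx (Y.occurs-nth i<))

  -- x lies below the cover of y that undoes this descent.
  descent-reversed : ∀ {t} → suc t < N → nth y (suc t) < nth y t → Precedes x (nth y (suc t)) (nth y t)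
  descent-reversed {t} h desc
    with precedes-total injx (occurs-transfer sy sx (Y.occurs-nth h))
                             (occurs-transfer sy sx (Y.occurs-nth (<-trans (n<1+n t) h))) (λ e → <-irrefl e desc)
  ... | inj₁ yₜ₊₁≺yₜ = yₜ₊₁≺yₜ
  ... | inj₂ in-order = ⊥-elim (precedes-asym (SignedPerm.injective word-signedPerm)
                                  (proj₂ (pop-lower z (inj₂ swap-covered) _ _ (desc , in-order))) swapped-pair-precedes)
    where open DescentSwap sy h desc

  descendingRun-reversed : ∀ {i j} → i < j → j < N → DescendingOn y i j → Precedes x (nth y j) (nth y i)
  descendingRun-reversed {i} {suc j} i<j j< desc with m≤n⇒m<n∨m≡n (≤-pred i<j)
  ... | inj₂ refl = descent-reversed j< (desc i ≤-refl ≤-refl)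
  ... | inj₁ i<j′ = precedes-trans injx (descent-reversed j< (desc j (<⇒≤ i<j′) ≤-refl))
                      (descendingRun-reversed i<j′ (<-trans (n<1+n j) j<) (λ k a b → desc k a (<-trans b (n<1+n j))))

  firstAscent : ∀ lo hi → hi < N →
                DescendingOn y lo hi ⊎ ∃[ t ] (lo ≤ t × t < hi × nth y t < nth y (suc t) × DescendingOn y lo t)
  firstAscent lo zero _ = inj₁ (λ k _ ())
  firstAscent lo (suc h) h< with firstAscent lo h (<-trans (n<1+n h) h<)
  ... | inj₂ (t , lo≤t , t<h , asc , desc) = inj₂ (t , lo≤t , <-trans t<h (n<1+n h) , asc , desc)
  ... | inj₁ desc with lo ≤? h
  ...   | no lo≰h = inj₁ (λ k lo≤k k<1+h → ⊥-elim (lo≰h (≤-trans lo≤k (≤-pred k<1+h))))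
  ...   | yes lo≤h with <-cmp (nth y (suc h)) (nth y h)
  ...     | tri< yₕ₊₁<yₕ _ _ = inj₁ extend
    where
    extend : DescendingOn y lo (suc h)
    extend k lo≤k k<1+h with m≤n⇒m<n∨m≡n (≤-pred k<1+h)
    ... | inj₁ k<h = desc k lo≤k k<h
    ... | inj₂ refl = yₕ₊₁<yₕ
  ...     | tri≈ _ eq _ = ⊥-elim (<-irrefl (sym (Y.nth-injective′ h< (<-trans (n<1+n h) h<) eq)) (n<1+n h))
  ...     | tri> _ _ yₕ<yₕ₊₁ = inj₂ (h , lo≤h , n<1+n h , yₕ<yₕ₊₁ , desc)

  -- Otherwise swapping the ascent (and its mirror) in x gives a lower bound of y and all its covers
  -- that is not below x.
  invertedAscent⇒adjacent : ∀ {t} → suc t < N → nth x t < nth x (suc t) →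
                            Precedes y (nth x (suc t)) (nth x t) → Adjacent y (nth x (suc t)) (nth x t)
  invertedAscent⇒adjacent {t} h asc xₜ₊₁≺xₜ with adjacent? y (nth x (suc t)) (nth x t)
  ... | yes adj = adj
  ... | no ¬adj =
    ⊥-elim (precedes-asym injx (proj₂ (pop-greatest w (SignedPerm⇒B word-signedPerm) lower _ _ (asc , swapped-pair-precedes)))
                               (X.precedes-nth (n<1+n t) h))
    where
    S : SignedSwap x t
    S = signedSwap x t (SignedPerm.length-≡ sx) h
    open SignedSwap S using () renaming (word to w)
    open SignedSwapProperties sx h S
    occurs-xₜ : Occurs x (nth x t)
    occurs-xₜ = X.occurs-nth (<-trans (n<1+n t) h)
    occurs-xₜ₊₁ : Occurs x (nth x (suc t))
    occurs-xₜ₊₁ = X.occurs-nth h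

    NewInversion : ℕ → ℕ → Set
    NewInversion a b = (b ≡ nth x (suc t) × a ≡ nth x t) ⊎ (b ≡ nth x (suc m) × a ≡ nth x m)

    new⇒inversion-y : ∀ {a b} → NewInversion a b → Inv y a b
    new⇒inversion-y (inj₁ (refl , refl)) = asc , xₜ₊₁≺xₜ
    new⇒inversion-y (inj₂ (refl , refl)) = subst₂ (Inv y) (sym nth-m) (sym nth-1+m) (Y.inversion-complement (asc , xₜ₊₁≺xₜ))

    inversion-w : ∀ {a b} → Inv w a b → Inv x a b ⊎ NewInversion a b
    inversion-w (a<b , b≺a) with precedes-unswap b≺a
    ... | inj₁ b≺a′ = inj₁ (a<b , b≺a′)
    ... | inj₂ new = inj₂ new

    new-not-adjacent : ∀ {a b} → NewInversion a b → ¬ Adjacent y b a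
    new-not-adjacent (inj₁ (refl , refl)) = ¬adj
    new-not-adjacent (inj₂ (refl , refl)) adj =
      ¬adj (subst₂ (Adjacent y) (X.complement-involutive occurs-xₜ₊₁) (X.complement-involutive occurs-xₜ)
                                (Y.adjacent-complement (subst₂ (Adjacent y) nth-1+m nth-m adj)))

    lower : ∀ s → Covering s → w ≤w s
    lower s cover a b inv with inversion-w inv | cover
    ... | inj₁ inv-x | _ = pop-lower s cover a b inv-x
    ... | inj₂ new | inj₁ refl = new⇒inversion-y new
    ... | inj₂ new | inj₂ cov = CoveredBy.nonadjacentInversion-kept sy cov (new⇒inversion-y new) (new-not-adjacent new)


  -- By induction on the distance of the two letters in x, looking at the letter right after the smaller one.
  ¬reversedAcrossAscent : ∀ d qU qV → qV ≡ suc (qU + d) → qV < N → ∀ α β τ → β < N → α ≤ τ → τ < β →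
                          nth y τ < nth y (suc τ) → nth y α ≡ nth x qV → nth y β ≡ nth x qU → nth x qU < nth x qV → ⊥
  ¬reversedAcrossAscent zero qU qV e qV< α β τ β< α≤τ τ<β ascτ eα eβ U<V rewrite e | +-identityʳ qU
    with invertedAscent⇒adjacent qV< U<V (Y.precedes-at (≤-<-trans α≤τ τ<β) β< eα eβ)
  ... | k , 1+k< , e₁ , e₂
    with Y.nth-injective′ (<-trans (n<1+n k) 1+k<) (<-trans (≤-<-trans α≤τ τ<β) β<) (trans e₁ (sym eα))
       | Y.nth-injective′ 1+k< β< (trans e₂ (sym eβ))
  ... | refl | refl with ≤-antisym α≤τ (≤-pred τ<β)
  ... | refl = <-asym U<V (subst₂ _<_ eα eβ ascτ)
  ¬reversedAcrossAscent (suc d) qU qV e qV< α β τ β< α≤τ τ<β ascτ eα eβ U<V = by-cases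
    where
    e′ : qV ≡ suc (suc qU + d)
    e′ = trans e (cong suc (+-suc qU d))
    qW<qV : suc qU < qV
    qW<qV = subst (suc qU <_) (sym e′) (s≤s (s≤s (m≤m+n qU d)))
    qW< : suc qU < N
    qW< = <-trans qW<qV qV<
    qU< : qU < N
    qU< = <-trans (n<1+n qU) qW<
    α<β : α < β
    α<β = ≤-<-trans α≤τ τ<β
    U V W : ℕ
    U = nth x qU
    V = nth x qV
    W = nth x (suc qU)
    πW : ℕ
    πW = yPos qW<
    πW< : πW < N
    πW< = yPos-< qW<
    eW : nth y πW ≡ W
    eW = nth-yPos qW<

    recurse : β < πW → W < V → ⊥
    recurse β<πW W<V = ¬reversedAcrossAscent d (suc qU) qV e′ qV< α πW τ πW< α≤τ (<-trans τ<β β<πW) ascτ eα eW W<V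

    adjacent : U < W → Precedes y (nth y πW) (nth y β) → suc πW ≡ β
    adjacent U<W W≺U with invertedAscent⇒adjacent qW< U<W (subst₂ (Precedes y) eW eβ W≺U)
    ... | k , 1+k< , e₁ , e₂ =
      trans (cong suc (sym (Y.nth-injective′ (<-trans (n<1+n k) 1+k<) πW< (trans e₁ (sym eW)))))
            (Y.nth-injective′ 1+k< β< (trans e₂ (sym eβ)))

    U≢W : U < W → nth y β ≢ nth y πW
    U≢W U<W eq = <-irrefl (trans (sym eβ) (trans eq eW)) U<W

    by-cases : ⊥
    by-cases with <-cmp W U
    ... | tri≈ _ eq _ = <-irrefl (sym (X.nth-injective′ qW< qU< eq)) (n<1+n qU)
    ... | tri< W<U _ _ = recurse (Y.precedes⇒< β< πW< eβ eW (proj₂ (pop-≤ _ _ (W<U , X.precedes-nth (n<1+n qU) qW<)))) (<-trans W<U U<V)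
    ... | tri> _ _ U<W with <-cmp W V
    ...   | tri≈ _ eq _ = <-irrefl (X.nth-injective′ qW< qV< eq) qW<qV
    ...   | tri< W<V _ _ with precedes-total injy (Y.occurs-nth β<) (Y.occurs-nth πW<) (U≢W U<W)
    ...     | inj₁ U≺W = recurse (Y.precedes⇒< β< πW< refl refl U≺W) W<V
    ...     | inj₂ W≺U with adjacent U<W W≺U
    ...       | refl = ¬reversedAcrossAscent d (suc qU) qV e′ qV< α πW τ πW< α≤τ τ<πW ascτ eα eW W<V
      where
      τ<πW : τ < πW
      τ<πW = ≤∧≢⇒< (≤-pred τ<β) (λ { refl → <-asym U<W (subst₂ _<_ eW eβ ascτ) })
    by-cases | tri> _ _ U<W | tri> _ _ V<W
      with Y.precedes⇒< πW< (<-trans α<β β<) eW eα (proj₂ (pop-≤ _ _ (V<W , X.precedes-nth qW<qV qV<)))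
    ... | πW<α with precedes-total injy (Y.occurs-nth β<) (Y.occurs-nth πW<) (U≢W U<W)
    ...   | inj₁ U≺W = <-asym (Y.precedes⇒< β< πW< refl refl U≺W) (<-trans πW<α α<β)
    ...   | inj₂ W≺U with adjacent U<W W≺U
    ...     | refl = <-irrefl refl (<-≤-trans πW<α (≤-pred α<β))


  ascentBetween⇒kept : ∀ {α β τ} → α ≤ τ → τ < β → β < N → nth y β < nth y α → nth y τ < nth y (suc τ) →
                       Precedes x (nth y α) (nth y β)
  ascentBetween⇒kept {α} {β} {τ} α≤τ τ<β β< yβ<yα asc
    with precedes-total injx (occurs-transfer sy sx (Y.occurs-nth (<-trans (≤-<-trans α≤τ τ<β) β<)))
                             (occurs-transfer sy sx (Y.occurs-nth β<)) (λ eq → <-irrefl (sym eq) yβ<yα)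
  ... | inj₁ kept = kept
  ... | inj₂ (qU , qV , qU<qV , qV< , eU , eV) =
    ⊥-elim (¬reversedAcrossAscent (qV ∸ suc qU) qU qV (sym (m+[n∸m]≡n qU<qV)) (X.<length⇒<N qV<) α β τ β< α≤τ τ<β asc
                                  (sym eV) (sym eU) (subst₂ _<_ (sym eU) (sym eV) yβ<yα))

  xInversion⇒yOrder : ∀ {q₁ q₂ π₁ π₂} → q₁ < q₂ → q₂ < N → π₁ < N → π₂ < N →
                      nth y π₁ ≡ nth x q₁ → nth y π₂ ≡ nth x q₂ → nth x q₂ < nth x q₁ → π₁ < π₂
  xInversion⇒yOrder q₁<q₂ q₂< π₁< π₂< e₁ e₂ lt = Y.precedes⇒< π₁< π₂< e₁ e₂ (proj₂ (pop-≤ _ _ (lt , X.precedes-nth q₁<q₂ q₂<)))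

  descendingRun⇒xOrder : ∀ {α β qα qβ} → α < β → β < N → DescendingOn y α β → qα < N → qβ < N →
                         nth x qα ≡ nth y α → nth x qβ ≡ nth y β → qβ < qα
  descendingRun⇒xOrder α<β β< desc qα< qβ< eα eβ = X.precedes⇒< qβ< qα< eβ eα (descendingRun-reversed α<β β< desc)

  ascentBetween⇒xOrder : ∀ {α β τ qα qβ} → α ≤ τ → τ < β → β < N → nth y β < nth y α → nth y τ < nth y (suc τ) →
                         qα < N → qβ < N → nth x qα ≡ nth y α → nth x qβ ≡ nth y β → qα < qβ
  ascentBetween⇒xOrder α≤τ τ<β β< lt asc qα< qβ< eα eβ = X.precedes⇒< qα< qβ< eα eβ (ascentBetween⇒kept α≤τ τ<β β< lt asc)

-- Two consecutive ascending runs of x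

module RunBoundary (n : ℕ) {x y : List ℕ} (Bx : B n x) (By : B n y) (pop : IsPopOf n y x)
  {i p j : ℕ} (i≤p : i ≤ p) (p<j : p < j) (j<N : j < n + n)
  (ascA : AscendingOn x i p) (ascD : AscendingOn x (suc p) j) (drop : ¬ (nth x p < nth x (suc p)))
  (start : RunStart x i) (end : RunEnd x j) where

  open SignedPermutations n
  open PopImage n Bx By pop

  p< : p < N
  p< = <-trans p<j j<N
  1+p< : suc p < N
  1+p< = ≤-<-trans p<j j<N
  i< : i < N
  i< = ≤-<-trans i≤p p<

  d<c : nth x (suc p) < nth x p
  d<c = ≤∧≢⇒< (≮⇒≥ drop) (λ eq → <-irrefl (sym (X.nth-injective′ 1+p< p< eq)) (n<1+n p))

  a≤c : nth x i ≤ nth x p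
  a≤c = ascendingOn-mono {x} ascA ≤-refl i≤p ≤-refl

  d≤b : nth x (suc p) ≤ nth x j
  d≤b = ascendingOn-mono {x} ascD ≤-refl p<j ≤-refl

  πa : ℕ
  πa = yPos i<
  πa< : πa < N
  πa< = yPos-< i<
  eπa : nth y πa ≡ nth x i
  eπa = nth-yPos i<
  πc : ℕ
  πc = yPos p<
  πc< : πc < N
  πc< = yPos-< p<
  eπc : nth y πc ≡ nth x p
  eπc = nth-yPos p<
  πd : ℕ
  πd = yPos 1+p<
  πd< : πd < N
  πd< = yPos-< 1+p<
  eπd : nth y πd ≡ nth x (suc p)
  eπd = nth-yPos 1+p<
  πb : ℕ
  πb = yPos j<N
  πb< : πb < N
  πb< = yPos-< j<N
  eπb : nth y πb ≡ nth x j
  eπb = nth-yPos j<N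

  predecessorAbove : ∀ {q} → q < i → ∃[ i′ ] (q ≤ i′ × i′ < i × nth x i < nth x i′)
  predecessorAbove {q} q<i = from-start start
    where
    from-start : RunStart x i → ∃[ i′ ] (q ≤ i′ × i′ < i × nth x i < nth x i′)
    from-start (inj₁ i≡0) = ⊥-elim (<-irrefl refl (<-≤-trans (subst (q <_) i≡0 q<i) z≤n))
    from-start (inj₂ (i′ , i≡1+i′ , a≯g)) =
      i′ , ≤-pred (subst (q <_) i≡1+i′ q<i) , i′<i ,
      ≤∧≢⇒< (≮⇒≥ a≯g) (λ eq → <-irrefl (X.nth-injective′ (<-trans i′<i i<) i< (sym eq)) i′<i)
      where
      i′<i : i′ < i
      i′<i = subst (i′ <_) (sym i≡1+i′) (n<1+n i′)

  successorBelow : ∀ {q} → j < q → q < N → nth x (suc j) < nth x j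
  successorBelow {q} j<q q< = from-end end
    where
    from-end : RunEnd x j → nth x (suc j) < nth x j
    from-end (inj₁ 1+j≡len) = ⊥-elim (<-irrefl refl (<-≤-trans q< (subst (_≤ q) (trans 1+j≡len (SignedPerm.length-≡ sx)) j<q)))
    from-end (inj₂ b≮h) = ≤∧≢⇒< (≮⇒≥ b≮h) (λ eq → <-irrefl (sym (X.nth-injective′ (≤-<-trans j<q q<) j<N eq)) (n<1+n j))

  πc<πd : πc < πd
  πc<πd = xInversion⇒yOrder (n<1+n p) 1+p< πc< πd< eπc eπd d<c

  -- The descent x_p > x_{p+1} cannot come from a descending run of y, which Pop would have reversed.
  ascentBetweenDescent : ∃[ t ] (πc ≤ t × t < πd × nth y t < nth y (suc t) × DescendingOn y πc t)
  ascentBetweenDescent with firstAscent πc πd πd<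
  ... | inj₂ ascent = ascent
  ... | inj₁ desc = ⊥-elim (<-asym (n<1+n p) (descendingRun⇒xOrder πc<πd πd< desc p< 1+p< (sym eπc) (sym eπd)))

  -- y_t ends the descending run of y that starts at x_p.
  module _ {t : ℕ} (πc≤t : πc ≤ t) (t<πd : t < πd) (asc : nth y t < nth y (suc t)) (descR : DescendingOn y πc t) where

    1+t< : suc t < N
    1+t< = ≤-<-trans t<πd πd<
    t< : t < N
    t< = <-trans (n<1+n t) 1+t<

    πa≰t⇒i≡p : t < πa → i < p → ⊥
    πa≰t⇒i≡p t<πa i<p with <-cmp πc πa
    ... | tri< πc<πa _ _ =
      <-asym i<p (ascentBetween⇒xOrder πc≤t t<πa πa< (subst₂ _<_ (sym eπa) (sym eπc) a<c) asc p< i< (sym eπc) (sym eπa))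
      where
      a<c : nth x i < nth x p
      a<c = ≤∧≢⇒< a≤c (λ eq → <-irrefl (X.nth-injective′ i< p< eq) i<p)
    ... | tri≈ _ eq _ = <-irrefl (X.nth-injective′ i< p< (trans (sym eπa) (trans (cong (nth y) (sym eq)) eπc))) i<p
    ... | tri> _ _ πa<πc = <-asym t<πa (<-≤-trans πa<πc πc≤t)

    ¬bottomBeforeRun : ∀ {qu} → qu < N → nth x qu ≡ nth y t → qu < i → nth y t < nth x i → ⊥
    ¬bottomBeforeRun {qu} qu< equ qu<i u<a with predecessorAbove qu<i
    ... | i′ , qu≤i′ , i′<i , a<g with m≤n⇒m<n∨m≡n qu≤i′
    ...   | inj₂ refl = <-asym u<a (subst (nth x i <_) equ a<g)
    ...   | inj₁ qu<i′ = by-cases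
      where
      i′< : i′ < N
      i′< = <-trans i′<i i<
      πg : ℕ
      πg = yPos i′<
      πg< : πg < N
      πg< = yPos-< i′<
      eπg : nth y πg ≡ nth x i′
      eπg = nth-yPos i′<
      πg<πa : πg < πa
      πg<πa = xInversion⇒yOrder i′<i i< πg< πa< eπg eπa a<g
      by-cases : ⊥
      by-cases with <-cmp πa t
      ... | tri≈ _ refl _ = <-irrefl eπa u<a
      ... | tri> _ _ t<πa with m≤n⇒m<n∨m≡n i≤p
      ...   | inj₁ i<p = πa≰t⇒i≡p t<πa i<p
      ...   | inj₂ refl = <-irrefl refl (<-≤-trans t<πa (≤-trans (≤-reflexive (Y.nth-injective′ πa< πc< (trans eπa (sym eπc)))) πc≤t))
      by-cases | tri< πa<t _ _ with firstAscent πg πa πa<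
      ... | inj₁ desc = <-asym i′<i (descendingRun⇒xOrder πg<πa πa< desc i′< i< (sym eπg) (sym eπa))
      ... | inj₂ (τ , πg≤τ , τ<πa , ascτ , _) =
        <-asym qu<i′ (ascentBetween⇒xOrder πg≤τ (<-trans τ<πa πa<t) t< (subst (nth y t <_) (sym eπg) (<-trans u<a a<g)) ascτ
                                           i′< qu< (sym eπg) equ)

    head≤bottom : nth x i ≤ nth y t
    head≤bottom = ≮⇒≥ u≮a
      where
      u≮a : ¬ (nth y t < nth x i)
      u≮a u<a with m≤n⇒m<n∨m≡n πc≤t | positionInX t<
      ... | inj₂ refl | _ = <-irrefl refl (<-≤-trans (subst (_< nth x i) eπc u<a) a≤c)
      ... | inj₁ πc<t | qu , qu< , equ with i ≤? qu
      ...   | yes i≤qu = <-irrefl (sym equ) (<-≤-trans u<a (ascendingOn-mono {x} ascA ≤-refl i≤qu (<⇒≤ qu<p)))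
        where
        qu<p : qu < p
        qu<p = descendingRun⇒xOrder πc<t t< descR p< qu< (sym eπc) equ
      ...   | no i≰qu = ¬bottomBeforeRun qu< equ (≰⇒> i≰qu) u<a

    ¬topBeforeDescent : ∀ {qv} → qv < N → nth x qv ≡ nth y (suc t) → qv < suc p → ⊥
    ¬topBeforeDescent {qv} qv< eqv qv<1+p with m≤n⇒m<n∨m≡n (≤-pred qv<1+p)
    ... | inj₂ refl = <-irrefl refl (≤-trans (≤-reflexive (sym (Y.nth-injective′ πc< 1+t< (trans eπc eqv)))) πc≤t)
    ... | inj₁ qv<p with <-cmp (nth x p) (nth y (suc t))
    ...   | tri< c<v _ _ = <-irrefl refl (<-≤-trans (xInversion⇒yOrder qv<p p< 1+t< πc< (sym eqv) eπc (subst (nth x p <_) (sym eqv) c<v))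
                                                    (≤-trans πc≤t (n≤1+n t)))
    ...   | tri≈ _ c≡v _ = <-irrefl refl (<-≤-trans (s≤s πc≤t) (≤-reflexive (Y.nth-injective′ 1+t< πc< (sym (trans eπc c≡v)))))
    ...   | tri> _ _ v<c = <-asym qv<p (ascentBetween⇒xOrder πc≤t (n<1+n t) 1+t< (subst (nth y (suc t) <_) (sym eπc) v<c) asc
                                                           p< qv< (sym eπc) eqv)

    ¬topAfterRun : ∀ {qv} → suc t < πd → qv < N → nth x qv ≡ nth y (suc t) → j < qv → nth x j < nth y (suc t) → ⊥
    ¬topAfterRun {qv} 1+t<πd qv< eqv j<qv b<v with m≤n⇒m<n∨m≡n j<qv | successorBelow j<qv qv<
    ... | inj₂ refl | h<b = <-asym b<v (subst (_< nth x j) eqv h<b)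
    ... | inj₁ 1+j<qv | h<b = by-cases
      where
      1+j< : suc j < N
      1+j< = <-trans 1+j<qv qv<
      πh : ℕ
      πh = yPos 1+j<
      πh< : πh < N
      πh< = yPos-< 1+j<
      eπh : nth y πh ≡ nth x (suc j)
      eπh = nth-yPos 1+j<
      πb<πh : πb < πh
      πb<πh = xInversion⇒yOrder (n<1+n j) 1+j< πb< πh< eπb eπh h<b
      ascentAfterTop : ∀ {τ} → suc t ≤ τ → τ < πh → nth y τ < nth y (suc τ) → ⊥
      ascentAfterTop 1+t≤τ τ<πh ascτ =
        <-asym 1+j<qv (ascentBetween⇒xOrder 1+t≤τ τ<πh πh< (subst (_< nth y (suc t)) (sym eπh) (<-trans h<b b<v)) ascτ
                                            qv< 1+j< eqv (sym eπh))
      by-cases : ⊥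
      by-cases with firstAscent πb πh πh<
      ... | inj₁ desc = <-asym (n<1+n j) (descendingRun⇒xOrder πb<πh πh< desc j<N 1+j< (sym eπb) (sym eπh))
      ... | inj₂ (τ , πb≤τ , τ<πh , ascτ , _) with <-cmp πb (suc t)
      ...   | tri> _ _ 1+t<πb = ascentAfterTop (≤-trans (<⇒≤ 1+t<πb) πb≤τ) τ<πh ascτ
      ...   | tri≈ _ πb≡1+t _ = <-irrefl (trans (sym eπb) (trans (cong (nth y) πb≡1+t) (sym eqv))) (subst (nth x j <_) (sym eqv) b<v)
      ...   | tri< πb<1+t _ _ with m≤n⇒m<n∨m≡n p<j
      ...     | inj₂ refl = <-irrefl (sym (Y.nth-injective′ πd< πb< (trans eπd (sym eπb)))) (<-trans πb<1+t 1+t<πd)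
      ...     | inj₁ 1+p<j with <-cmp πd πb
      ...       | tri< πd<πb _ _ = <-asym πd<πb (<-trans πb<1+t 1+t<πd)
      ...       | tri≈ _ πd≡πb _ = <-irrefl (X.nth-injective′ 1+p< j<N (trans (sym eπd) (trans (cong (nth y) πd≡πb) eπb))) 1+p<j
      ...       | tri> _ _ πb<πd with τ <? πd
      ...         | yes τ<πd = <-asym 1+p<j (ascentBetween⇒xOrder πb≤τ τ<πd πd< (subst₂ _<_ (sym eπd) (sym eπb) d<b) ascτ
                                                              j<N 1+p< (sym eπb) (sym eπd))
        where
        d<b : nth x (suc p) < nth x j
        d<b = ≤∧≢⇒< d≤b (λ eq → <-irrefl (X.nth-injective′ 1+p< j<N eq) 1+p<j)
      ...         | no τ≮πd = ascentAfterTop (≤-trans (<⇒≤ 1+t<πd) (≮⇒≥ τ≮πd)) τ<πh ascτ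

    top≤last : nth y (suc t) ≤ nth x j
    top≤last = ≮⇒≥ b≮v
      where
      b≮v : ¬ (nth x j < nth y (suc t))
      b≮v b<v with m≤n⇒m<n∨m≡n t<πd | positionInX 1+t<
      ... | inj₂ 1+t≡πd | _ = <-irrefl refl (<-≤-trans (subst (nth x j <_) (trans (cong (nth y) 1+t≡πd) eπd) b<v) d≤b)
      ... | inj₁ 1+t<πd | qv , qv< , eqv with firstAscent (suc t) πd πd<
      ...   | inj₂ (τ , 1+t≤τ , τ<πd , ascτ , _) =
        ¬topBeforeDescent qv< eqv (ascentBetween⇒xOrder 1+t≤τ τ<πd πd< (subst (_< nth y (suc t)) (sym eπd) (≤-<-trans d≤b b<v)) ascτ
                                                        qv< 1+p< eqv (sym eπd))
      ...   | inj₁ desc with qv ≤? j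
      ...     | yes qv≤j = <-irrefl refl (≤-<-trans (subst (_≤ nth x j) eqv (ascendingOn-mono {x} ascD (<⇒≤ 1+p<qv) qv≤j ≤-refl)) b<v)
        where
        1+p<qv : suc p < qv
        1+p<qv = descendingRun⇒xOrder 1+t<πd πd< desc qv< 1+p< eqv (sym eπd)
      ...     | no qv≰j = ¬topAfterRun 1+t<πd qv< eqv (≰⇒> qv≰j) b<v

  head<last : nth x i < nth x j
  head<last = through ascentBetweenDescent
    where
    through : ∃[ t ] (πc ≤ t × t < πd × nth y t < nth y (suc t) × DescendingOn y πc t) → nth x i < nth x j
    through (t , πc≤t , t<πd , asc , descR) =
      ≤-<-trans (head≤bottom πc≤t t<πd asc descR) (<-≤-trans asc (top≤last πc≤t t<πd asc descR))

-- Reading the ascending runs off a word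

ascendingOn-suc : ∀ {a l lo hi} → AscendingOn l lo hi → AscendingOn (a ∷ l) (suc lo) (suc hi)
ascendingOn-suc asc (suc k) (s≤s lo≤k) (s≤s k<hi) = asc k lo≤k k<hi

ascendingOn-∷ : ∀ {a b l hi} → a < b → AscendingOn (b ∷ l) 0 hi → AscendingOn (a ∷ b ∷ l) 0 (suc hi)
ascendingOn-∷ a<b asc zero _ _ = a<b
ascendingOn-∷ a<b asc (suc k) _ (s≤s k<hi) = asc k z≤n k<hi

runEnd-suc : ∀ a {l j} → RunEnd l j → RunEnd (a ∷ l) (suc j)
runEnd-suc a (inj₁ e) = inj₁ (cong suc e)
runEnd-suc a (inj₂ ¬asc) = inj₂ ¬asc

last-∷ : ∀ {a b : ℕ} {r : List ℕ} {v} → head r ≡ just b → last r ≡ v → last (a ∷ r) ≡ v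
last-∷ {r = c ∷ r} _ e = e

runsFrom≢[] : ∀ a xs → runsFrom a xs ≢ []
runsFrom≢[] a (b ∷ xs) e with a <? b
runsFrom≢[] a (b ∷ xs) e | yes _ with runsFrom b xs
runsFrom≢[] a (b ∷ xs) () | yes _ | []
runsFrom≢[] a (b ∷ xs) () | yes _ | _ ∷ _
runsFrom≢[] a (b ∷ xs) () | no _

firstRun-segment : ∀ a xs r → runsFrom a xs ‼ 0 ≡ just r →
                   ∃[ e ] (e < length (a ∷ xs) × head r ≡ just a × last r ≡ just (nth (a ∷ xs) e) ×
                           AscendingOn (a ∷ xs) 0 e × RunEnd (a ∷ xs) e)
firstRun-segment a [] r refl = 0 , s≤s z≤n , refl , refl , (λ k _ ()) , inj₁ refl
firstRun-segment a (b ∷ xs) r h with a <? b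
... | no a≮b with h
...   | refl = 0 , s≤s z≤n , refl , refl , (λ k _ ()) , inj₂ a≮b
firstRun-segment a (b ∷ xs) r h | yes a<b with runsFrom b xs | firstRun-segment b xs | runsFrom≢[] b xs
...   | [] | _ | ≢[] = ⊥-elim (≢[] refl)
...   | r′ ∷ rs | rec | _ with h
...     | refl with rec r′ refl
...       | e , e< , hd , ls , asc , end = suc e , s≤s e< , refl , last-∷ hd ls , ascendingOn-∷ a<b asc , runEnd-suc a end

-- The run counted k from the left starts at position i.
RunStartAt : List ℕ → ℕ → ℕ → Set
RunStartAt l k i = (k ≡ 0 × i ≡ 0) ⊎ ∃[ k′ ] (k ≡ suc k′ × ∃[ i′ ] (i ≡ suc i′ × ¬ (nth l i′ < nth l i)))

runStartAt⇒runStart : ∀ {l k i} → RunStartAt l k i → RunStart l i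
runStartAt⇒runStart (inj₁ (_ , i≡0)) = inj₁ i≡0
runStartAt⇒runStart (inj₂ (_ , _ , i′ , i≡1+i′ , ¬asc)) = inj₂ (i′ , i≡1+i′ , ¬asc)

-- Runs r and s are l[i..p] and l[p+1..j].
ConsecutiveRuns : List ℕ → ℕ → List ℕ → List ℕ → Set
ConsecutiveRuns l k r s =
  ∃[ i ] ∃[ p ] ∃[ j ] (i ≤ p × p < j × j < length l × head r ≡ just (nth l i) × last s ≡ just (nth l j) ×
                        AscendingOn l i p × AscendingOn l (suc p) j × ¬ (nth l p < nth l (suc p)) × RunStartAt l k i × RunEnd l j)

consecutiveRuns : ∀ a xs k r s → runsFrom a xs ‼ k ≡ just r → runsFrom a xs ‼ suc k ≡ just s → ConsecutiveRuns (a ∷ xs) k r s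
consecutiveRuns a (b ∷ xs) k r s rₖ sₖ₊₁ with a <? b
consecutiveRuns a (b ∷ xs) zero r s refl sₖ₊₁ | no a≮b with firstRun-segment b xs s sₖ₊₁
... | e , e< , hd , ls , asc , end =
  0 , 0 , suc e , z≤n , s≤s z≤n , s≤s e< , refl , ls , (λ k _ ()) , ascendingOn-suc asc , a≮b , inj₁ (refl , refl) , runEnd-suc a end
consecutiveRuns a (b ∷ xs) (suc k) r s rₖ sₖ₊₁ | no a≮b with consecutiveRuns b xs k r s rₖ sₖ₊₁
... | i , p , j , i≤p , p<j , j< , hd , ls , ascA , ascD , drop , start , end =
  suc i , suc p , suc j , s≤s i≤p , s≤s p<j , s≤s j< , hd , ls , ascendingOn-suc ascA , ascendingOn-suc ascD , drop ,
  shift start , runEnd-suc a end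
  where
  shift : RunStartAt (b ∷ xs) k i → RunStartAt (a ∷ b ∷ xs) (suc k) (suc i)
  shift (inj₁ (refl , refl)) = inj₂ (k , refl , 0 , refl , a≮b)
  shift (inj₂ (_ , _ , i′ , refl , ¬asc)) = inj₂ (k , refl , suc i′ , refl , ¬asc)
consecutiveRuns a (b ∷ xs) k r s rₖ sₖ₊₁ | yes a<b with runsFrom b xs | consecutiveRuns b xs | runsFrom≢[] b xs
... | [] | _ | ≢[] = ⊥-elim (≢[] refl)
... | r′ ∷ rs | rec | _ with k
...   | zero with rₖ | rec 0 r′ s refl sₖ₊₁
...     | refl | i , p , j , i≤p , p<j , j< , hd , ls , ascA , ascD , drop , inj₂ (_ , () , _) , end
...     | refl | i , p , j , i≤p , p<j , j< , hd , ls , ascA , ascD , drop , inj₁ (_ , refl) , end =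
          0 , suc p , suc j , z≤n , s≤s p<j , s≤s j< , refl , ls , ascendingOn-∷ a<b ascA , ascendingOn-suc ascD , drop ,
          inj₁ (refl , refl) , runEnd-suc a end
consecutiveRuns a (b ∷ xs) k r s rₖ sₖ₊₁ | yes a<b | r′ ∷ rs | rec | _ | suc k′ with rec (suc k′) r s rₖ sₖ₊₁
... | i , p , j , i≤p , p<j , j< , hd , ls , ascA , ascD , drop , inj₁ (() , _) , end
... | i , p , j , i≤p , p<j , j< , hd , ls , ascA , ascD , drop , inj₂ (_ , _ , i′ , refl , ¬asc) , end =
  suc (suc i′) , suc p , suc j , s≤s i≤p , s≤s p<j , s≤s j< , hd , ls , ascendingOn-suc ascA , ascendingOn-suc ascD , drop ,
  inj₂ (k′ , refl , suc i′ , refl , ¬asc) , runEnd-suc a end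

mainTheorem3 : (n : ℕ) (x : List ℕ) → InPopImage n x →
    (k : ℕ) (r s : List ℕ) → ascRuns x ‼ k ≡ just r → ascRuns x ‼ suc k ≡ just s →
    (a b : ℕ) → head r ≡ just a → last s ≡ just b → a < b
mainTheorem3 n (c ∷ xs) (y , By , pop) k r s rₖ sₖ₊₁ a b ha hb with consecutiveRuns c xs k r s rₖ sₖ₊₁
... | i , p , j , i≤p , p<j , j< , hd , ls , ascA , ascD , drop , start , end =
  subst₂ _<_ (just-injective (trans (sym hd) ha)) (just-injective (trans (sym ls) hb))
    (RunBoundary.head<last n (proj₁ pop) By pop i≤p p<j j<N ascA ascD drop (runStartAt⇒runStart {c ∷ xs} start) end)
  where
  open SignedPermutations n using (B⇒SignedPerm; module SignedPerm)
  j<N : j < n + n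
  j<N = subst (j <_) (SignedPerm.length-≡ (B⇒SignedPerm (proj₁ pop))) j<
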